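{- Let $\mathbf{w}$ be an infinite binary word which avoids $(5/2)^+$-powers, and suppose that the set of length-4 factors of $\mathbf{w}$ is $F=\{0110,1001,0011,1100,0010,0100,1101,1010\}$. Then some final segment (suffix) of $\mathbf{w}$ has the form $g(\mathbf{u})$ for some proper $\mathbf{u}\in\Sigma_3^\omega$, where $g:\Sigma_3^*\to\Sigma_2^*$ is the morphism $g(0)=011,\ g(1)=0,\ g(2)=01$ (extended to infinite words).
   Context: $\Sigma_2=\{0,1\}$, $\Sigma_3=\{0,1,2\}$. For a finite word of length $\ell$ with smallest period $p$, its exponent is $\ell/p$; a $(5/2)^+$-power is a word of exponent $>5/2$; a word avoids $(5/2)^+$-powers if none of its factors is a $(5/2)^+$-power. Parikh vector $\pi(u)=[|u|_0,|u|_1,|u|_2]$; $\pi(x)>\pi(y)$ means $|x|_i\ge|y|_i$ for all $i$ with strict inequality for at least one $i$. A finite word $u\in\Sigma_3^*$ is proper if (1) it has no factor $xyxyx$ with $\pi(x)>\pi(y)$, and (2) none of $00,11,22,20,10101,2121,10210210$ is a factor of $u$. An infinite word over $\Sigma_3$ is proper if all its finite factors are proper. -}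

module Defs where

open import Data.Nat using (ℕ; zero; suc; _+_; _*_; _∸_; _≤_; _<_)
open import Data.Fin using (Fin; zero; suc; _≟_)
open import Data.List using (List; []; _∷_; _++_; length; take; drop; filter; concatMap)
open import Data.List.Membership.Propositional using (_∈_)
open import Data.Product using (Σ; ∃; _×_; _,_)
open import Relation.Binary.PropositionalEquality using (_≡_)
open import Relation.Nullary using (¬_)
open import Function.Bundles using (_⇔_)

Σ₂ : Set
Σ₂ = Fin 2

Σ₃ : Set
Σ₃ = Fin 3

0₂ 1₂ : Σ₂
0₂ = zero
1₂ = suc zero

0₃ 1₃ 2₃ : Σ₃
0₃ = zero
1₃ = suc zero
2₃ = suc (suc zero)

slice : {A : Set} → (ℕ → A) → ℕ → ℕ → List A
slice w i zero    = []
slice w i (suc n) = w i ∷ slice w (suc i) n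

FactorOf : {A : Set} → List A → List A → Set
FactorOf {A} u v = Σ (List A) λ a → Σ (List A) λ b → v ≡ a ++ u ++ b

FactorOfInf : {A : Set} → List A → (ℕ → A) → Set
FactorOfInf u w = ∃ λ i → slice w i (length u) ≡ u

IsPeriod : {A : Set} → ℕ → List A → Set
IsPeriod p u = (1 ≤ p) × (p ≤ length u) × (take (length u ∸ p) u ≡ drop p u)

IsSmallestPeriod : {A : Set} → ℕ → List A → Set
IsSmallestPeriod p u = IsPeriod p u × (∀ q → IsPeriod q u → p ≤ q)

-- exponent |u|/p > 5/2  ⇔  2|u| > 5p
Is52PlusPower : {A : Set} → List A → Set
Is52PlusPower u = ∃ λ p → IsSmallestPeriod p u × (5 * p < 2 * length u)

Avoids52PlusInf : {A : Set} → (ℕ → A) → Set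
Avoids52PlusInf w = ∀ u → FactorOfInf u w → ¬ Is52PlusPower u

cnt : Σ₃ → List Σ₃ → ℕ
cnt a x = length (filter (_≟ a) x)

ParikhGt : List Σ₃ → List Σ₃ → Set
ParikhGt x y = (∀ a → cnt a y ≤ cnt a x) × (∃ λ a → cnt a y < cnt a x)

forbidden : List (List Σ₃)
forbidden =
  (0₃ ∷ 0₃ ∷ []) ∷
  (1₃ ∷ 1₃ ∷ []) ∷
  (2₃ ∷ 2₃ ∷ []) ∷
  (2₃ ∷ 0₃ ∷ []) ∷
  (1₃ ∷ 0₃ ∷ 1₃ ∷ 0₃ ∷ 1₃ ∷ []) ∷
  (2₃ ∷ 1₃ ∷ 2₃ ∷ 1₃ ∷ []) ∷
  (1₃ ∷ 0₃ ∷ 2₃ ∷ 1₃ ∷ 0₃ ∷ 2₃ ∷ 1₃ ∷ 0₃ ∷ []) ∷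
  []

ProperFin : List Σ₃ → Set
ProperFin u =
  (∀ x y → FactorOf (x ++ y ++ x ++ y ++ x) u → ¬ ParikhGt x y) ×
  (∀ f → f ∈ forbidden → ¬ FactorOf f u)

ProperInf : (ℕ → Σ₃) → Set
ProperInf u = ∀ v → FactorOfInf v u → ProperFin v

g₁ : Σ₃ → List Σ₂
g₁ zero             = 0₂ ∷ 1₂ ∷ 1₂ ∷ []
g₁ (suc zero)       = 0₂ ∷ []
g₁ (suc (suc zero)) = 0₂ ∷ 1₂ ∷ []

g : List Σ₃ → List Σ₂
g = concatMap g₁

-- w ≡ g(u) for infinite words: g(u) is the infinite word of which every
-- g(u[0..n)) is a prefix (g is non-erasing, so this determines it).
IsGImage : (ℕ → Σ₂) → (ℕ → Σ₃) → Set
IsGImage w u = ∀ n → slice w 0 (length (g (slice u 0 n))) ≡ g (slice u 0 n)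

suffix : {A : Set} → (ℕ → A) → ℕ → (ℕ → A)
suffix w k i = w (k + i)

F : List (List Σ₂)
F =
  (0₂ ∷ 1₂ ∷ 1₂ ∷ 0₂ ∷ []) ∷
  (1₂ ∷ 0₂ ∷ 0₂ ∷ 1₂ ∷ []) ∷
  (0₂ ∷ 0₂ ∷ 1₂ ∷ 1₂ ∷ []) ∷
  (1₂ ∷ 1₂ ∷ 0₂ ∷ 0₂ ∷ []) ∷
  (0₂ ∷ 0₂ ∷ 1₂ ∷ 0₂ ∷ []) ∷
  (0₂ ∷ 1₂ ∷ 0₂ ∷ 0₂ ∷ []) ∷
  (1₂ ∷ 1₂ ∷ 0₂ ∷ 1₂ ∷ []) ∷
  (1₂ ∷ 0₂ ∷ 1₂ ∷ 0₂ ∷ []) ∷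
  []

Length4FactorsAre : (ℕ → Σ₂) → List (List Σ₂) → Set
Length4FactorsAre w S = ∀ v → length v ≡ 4 → (FactorOfInf v w ⇔ v ∈ S)

-- The word w contains no 111 (no word 111x lies in F), so after its first 0 it
-- factors uniquely into the blocks 011, 0, 01 = g(0), g(1), g(2), each followed by
-- a 0; reading off the blocks gives u with g(u) a suffix of w. The u is proper
-- because w avoids (5/2)⁺-powers and has only the factors F of length 4: if x y x y x
-- occurs in u with π(x) > π(y), then |g(x)| > |g(y)| and g(x)g(y)g(x)g(y)g(x) is a
-- (5/2)⁺-power in w; and for each forbidden factor f (extended by every possible next
-- letter where necessary) the occurrence of g(f)0 in w contains a length-4 factor
-- outside F or a (5/2)⁺-power.
module Submission where

open import Defs
open import Data.Nat using (ℕ; zero; suc; z≤n; s≤s; _+_; _*_; _∸_; _≤_; _<_; _≤?_; _<?_)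
open import Data.Nat.Properties
  using (+-identityʳ; +-comm; +-suc; +-assoc; m≤m+n; +-monoʳ-<; *-monoʳ-≤; ≤-<-trans;
         ≤-trans; <⇒≤; ≮⇒≥; m+n∸m≡n; ≤-refl; +-mono-≤; +-mono-<-≤; +-mono-≤-<; *-monoʳ-<; module ≤-Reasoning)
open import Data.Nat.Induction using (<-rec)
open import Data.Nat.Tactic.RingSolver using (solve-∀)
open import Data.Fin using (Fin; zero; suc; _≟_; toℕ; fromℕ<)
open import Data.Fin.Properties using (any?; toℕ<n; toℕ-fromℕ<)
open import Data.List using (List; []; _∷_; _++_; length; take; drop)
open import Data.List.Properties
  using (≡-dec; length-++; length-++-≤ˡ; ∷-injectiveˡ; ∷-injectiveʳ; ++-assoc; take++drop≡id; concatMap-++)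
open import Data.List.Membership.DecPropositional (≡-dec (_≟_ {2})) using (_∈?_)
open import Data.List.Relation.Unary.All using (All; []; _∷_; lookup)
open import Data.Product using (Σ; ∃; _×_; _,_; proj₁; proj₂)
open import Data.Empty using (⊥; ⊥-elim)
open import Data.Unit using (tt)
open import Relation.Binary.Definitions using (DecidableEquality)
open import Relation.Binary.PropositionalEquality
open import Relation.Nullary using (¬_; Dec; yes; no)
open import Relation.Nullary.Decidable using (True; False; toWitness; toWitnessFalse; _×-dec_)
open import Function.Bundles using (Equivalence)

module _ {A : Set} where

  take-length-++ : (a b : List A) → take (length a) (a ++ b) ≡ a
  take-length-++ []      b = refl
  take-length-++ (x ∷ a) b = cong (x ∷_) (take-length-++ a b)

  drop-length-++ : (a b : List A) → drop (length a) (a ++ b) ≡ b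
  drop-length-++ []      b = refl
  drop-length-++ (x ∷ a) b = drop-length-++ a b

  take-drop-factor : ∀ o l (v : List A) → FactorOf (take l (drop o v)) v
  take-drop-factor o l v = take o v , drop l (drop o v) , (begin
    v                                                   ≡⟨ take++drop≡id o v ⟨
    take o v ++ drop o v                                ≡⟨ cong (take o v ++_) (take++drop≡id l _) ⟨
    take o v ++ take l (drop o v) ++ drop l (drop o v)  ∎)
    where open ≡-Reasoning

  slice-+ : (w : ℕ → A) → ∀ i m n → slice w i (m + n) ≡ slice w i m ++ slice w (i + m) n
  slice-+ w i zero    n rewrite +-identityʳ i = refl
  slice-+ w i (suc m) n rewrite +-suc i m     = cong (w i ∷_) (slice-+ w (suc i) m n)

  slice-suffix : (w : ℕ → A) → ∀ k i n → slice (suffix w k) i n ≡ slice w (k + i) n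
  slice-suffix w k i zero    = refl
  slice-suffix w k i (suc n) rewrite slice-suffix w k (suc i) n | +-suc k i = refl

  slice-prefix : (w : ℕ → A) → ∀ i (v b : List A) →
                 slice w i (length (v ++ b)) ≡ v ++ b → slice w i (length v) ≡ v
  slice-prefix w i []      b eq = refl
  slice-prefix w i (x ∷ v) b eq =
    cong₂ _∷_ (∷-injectiveˡ eq) (slice-prefix w (suc i) v b (∷-injectiveʳ eq))

  slice-infix : (w : ℕ → A) → ∀ i (a v b : List A) →
                slice w i (length (a ++ v ++ b)) ≡ a ++ v ++ b →
                slice w (i + length a) (length v) ≡ v
  slice-infix w i []      v b eq rewrite +-identityʳ i     = slice-prefix w i v b eq
  slice-infix w i (x ∷ a) v b eq rewrite +-suc i (length a) = slice-infix w (suc i) a v b (∷-injectiveʳ eq)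

  factorOfInf-extend : ∀ {v : List A} {w : ℕ → A} → FactorOfInf v w → ∃ λ c → FactorOfInf (v ++ c ∷ []) w
  factorOfInf-extend {v} {w} (j , eq) = w (j + length v) , j , (begin
    slice w j (length (v ++ w (j + length v) ∷ []))   ≡⟨ cong (slice w j) (length-++ v) ⟩
    slice w j (length v + 1)                          ≡⟨ slice-+ w j (length v) 1 ⟩
    slice w j (length v) ++ w (j + length v) ∷ []     ≡⟨ cong (_++ w (j + length v) ∷ []) eq ⟩
    v ++ w (j + length v) ∷ []                        ∎)
    where open ≡-Reasoning

  factorOfInf-trans : ∀ {v v′ : List A} {w : ℕ → A} → FactorOf v v′ → FactorOfInf v′ w → FactorOfInf v w
  factorOfInf-trans {w = w} (a , b , refl) (i , eq) = i + length a , slice-infix w i a _ b eq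

  border⇒period : ∀ (s p b r : List A) → 1 ≤ length p → s ≡ p ++ b → s ≡ b ++ r → IsPeriod (length p) s
  border⇒period s p b r 1≤|p| refl s≡br = 1≤|p| , |p|≤|pb| , (begin
    take (length (p ++ b) ∸ length p) (p ++ b) ≡⟨ cong₂ take |pb|∸|p|≡|b| s≡br ⟩
    take (length b) (b ++ r)                   ≡⟨ take-length-++ b r ⟩
    b                                          ≡⟨ drop-length-++ p b ⟨
    drop (length p) (p ++ b)                   ∎)
    where
    open ≡-Reasoning
    |p|≤|pb| : length p ≤ length (p ++ b)
    |p|≤|pb| = subst (length p ≤_) (sym (length-++ p)) (m≤m+n _ _)
    |pb|∸|p|≡|b| : length (p ++ b) ∸ length p ≡ length b
    |pb|∸|p|≡|b| = trans (cong (_∸ length p) (length-++ p)) (m+n∸m≡n (length p) (length b))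

  xyxyx-period : (x y : List A) → 1 ≤ length (x ++ y) → IsPeriod (length (x ++ y)) (x ++ y ++ x ++ y ++ x)
  xyxyx-period x y 1≤|xy| = border⇒period _ (x ++ y) (x ++ y ++ x) (y ++ x) 1≤|xy|
    (sym (++-assoc x y _))
    (sym (trans (++-assoc x (y ++ x) (y ++ x)) (cong (x ++_) (++-assoc y x (y ++ x)))))

module _ {A : Set} (_≟ᴬ_ : DecidableEquality A) where

  isPeriod? : ∀ q (s : List A) → Dec (IsPeriod q s)
  isPeriod? q s = (1 ≤? q) ×-dec (q ≤? length s) ×-dec ≡-dec _≟ᴬ_ (take (length s ∸ q) s) (drop q s)

  period⇒smallestPeriod : ∀ (s : List A) q → IsPeriod q s → ∃ λ p → IsSmallestPeriod p s × p ≤ q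
  period⇒smallestPeriod s = <-rec _ smallest
    where
    smallest : ∀ q → (∀ {q′} → q′ < q → IsPeriod q′ s → ∃ λ p → IsSmallestPeriod p s × p ≤ q′) →
               IsPeriod q s → ∃ λ p → IsSmallestPeriod p s × p ≤ q
    smallest q below per with any? (λ (i : Fin q) → isPeriod? (toℕ i) s)
    ... | yes (i , per-i) =
      let p , p-smallest , p≤i = below (toℕ<n i) per-i in p , p-smallest , ≤-trans p≤i (<⇒≤ (toℕ<n i))
    ... | no none-below = q , (per , q-least) , ≤-refl
      where
      q-least : ∀ q′ → IsPeriod q′ s → q ≤ q′
      q-least q′ per′ = ≮⇒≥ λ q′<q →
        none-below (fromℕ< q′<q , subst (λ r → IsPeriod r s) (sym (toℕ-fromℕ< q′<q)) per′)

  period⇒52PlusPower : ∀ (s : List A) q → IsPeriod q s → 5 * q < 2 * length s → Is52PlusPower s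
  period⇒52PlusPower s q per 5q<2|s| =
    let p , p-smallest , p≤q = period⇒smallestPeriod s q per
    in  p , p-smallest , ≤-<-trans (*-monoʳ-≤ 5 p≤q) 5q<2|s|

  xyxyx-52PlusPower : (x y : List A) → length y < length x → Is52PlusPower (x ++ y ++ x ++ y ++ x)
  xyxyx-52PlusPower x y |y|<|x| = period⇒52PlusPower _ _ (xyxyx-period x y 1≤|xy|) (begin-strict
    5 * length (x ++ y)                    ≡⟨ cong (5 *_) (length-++ x) ⟩
    5 * (X + Y)                            ≡⟨ split-off-n X Y ⟩
    5 * X + 4 * Y + Y                      <⟨ +-monoʳ-< (5 * X + 4 * Y) |y|<|x| ⟩
    5 * X + 4 * Y + X                      ≡⟨ merge-m X Y ⟩
    2 * (X + (Y + (X + (Y + X))))          ≡⟨ cong (2 *_) (sym length-xyxyx) ⟩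
    2 * length (x ++ y ++ x ++ y ++ x)     ∎)
    where
    open ≤-Reasoning
    X = length x
    Y = length y
    split-off-n : ∀ m n → 5 * (m + n) ≡ 5 * m + 4 * n + n
    split-off-n = solve-∀
    merge-m : ∀ m n → 5 * m + 4 * n + m ≡ 2 * (m + (n + (m + (n + m))))
    merge-m = solve-∀
    1≤|xy| : 1 ≤ length (x ++ y)
    1≤|xy| = ≤-trans (≤-trans (s≤s z≤n) |y|<|x|) (length-++-≤ˡ x)
    length-xyxyx : length (x ++ y ++ x ++ y ++ x) ≡ X + (Y + (X + (Y + X)))
    length-xyxyx rewrite length-++ x {y ++ x ++ y ++ x} | length-++ y {x ++ y ++ x}
                       | length-++ x {y ++ x} | length-++ y {x} = refl

g-++ : (a b : List Σ₃) → g (a ++ b) ≡ g a ++ g b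
g-++ = concatMap-++ g₁

g-xyxyx : ∀ x y → g (x ++ y ++ x ++ y ++ x) ≡ g x ++ g y ++ g x ++ g y ++ g x
g-xyxyx x y rewrite g-++ x (y ++ x ++ y ++ x) | g-++ y (x ++ y ++ x) | g-++ x (y ++ x) | g-++ y x = refl

length-g : ∀ x → length (g x) ≡ 3 * cnt 0₃ x + cnt 1₃ x + 2 * cnt 2₃ x
length-g []                   = refl
length-g (zero ∷ x)           rewrite length-g x = count0 (cnt 0₃ x) (cnt 1₃ x) (cnt 2₃ x)
  where
  count0 : ∀ a b c → 3 + (3 * a + b + 2 * c) ≡ 3 * suc a + b + 2 * c
  count0 = solve-∀
length-g (suc zero ∷ x)       rewrite length-g x = count1 (cnt 0₃ x) (cnt 1₃ x) (cnt 2₃ x)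
  where
  count1 : ∀ a b c → 1 + (3 * a + b + 2 * c) ≡ 3 * a + suc b + 2 * c
  count1 = solve-∀
length-g (suc (suc zero) ∷ x) rewrite length-g x = count2 (cnt 0₃ x) (cnt 1₃ x) (cnt 2₃ x)
  where
  count2 : ∀ a b c → 2 + (3 * a + b + 2 * c) ≡ 3 * a + b + 2 * suc c
  count2 = solve-∀

ParikhGt⇒length-g< : ∀ x y → ParikhGt x y → length (g y) < length (g x)
ParikhGt⇒length-g< x y (y≤x , a , y<x) rewrite length-g x | length-g y = strict a y<x
  where
  strict : ∀ a → cnt a y < cnt a x →
           3 * cnt 0₃ y + cnt 1₃ y + 2 * cnt 2₃ y < 3 * cnt 0₃ x + cnt 1₃ x + 2 * cnt 2₃ x
  strict zero             lt = +-mono-<-≤ (+-mono-<-≤ (*-monoʳ-< 3 lt) (y≤x 1₃)) (*-monoʳ-≤ 2 (y≤x 2₃))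
  strict (suc zero)       lt = +-mono-<-≤ (+-mono-≤-< (*-monoʳ-≤ 3 (y≤x 0₃)) lt) (*-monoʳ-≤ 2 (y≤x 2₃))
  strict (suc (suc zero)) lt = +-mono-≤-< (+-mono-≤ (*-monoʳ-≤ 3 (y≤x 0₃)) (y≤x 1₃)) (*-monoʳ-< 2 lt)

No111 : (ℕ → Σ₂) → Set
No111 w = ∀ i → w i ≡ 1₂ → w (1 + i) ≡ 1₂ → w (2 + i) ≡ 1₂ → ⊥

blockLetter : Σ₂ → Σ₂ → Σ₃
blockLetter zero       _          = 1₃
blockLetter (suc zero) zero       = 2₃
blockLetter (suc zero) (suc zero) = 0₃

module Decoding (w : ℕ → Σ₂) (no111 : No111 w) where

  letterAt : ℕ → Σ₃
  letterAt i = blockLetter (w (1 + i)) (w (2 + i))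

  blockLength : ℕ → ℕ
  blockLength i = length (g₁ (letterAt i))

  block-at-0 : ∀ i → w i ≡ 0₂ → slice w i (blockLength i) ≡ g₁ (letterAt i) × w (i + blockLength i) ≡ 0₂
  block-at-0 i e₀ with w (1 + i) in e₁ | w (2 + i) in e₂
  ... | zero     | _        rewrite e₀ | +-comm i 1 = refl , e₁
  ... | suc zero | zero     rewrite e₀ | e₁ | +-comm i 2 = refl , e₂
  ... | suc zero | suc zero with w (3 + i) in e₃
  ...   | zero     rewrite e₀ | e₁ | e₂ | +-comm i 3 = refl , e₃
  ...   | suc zero = ⊥-elim (no111 (1 + i) e₁ e₂ e₃)

  first-0 : ∃ λ k → w k ≡ 0₂
  first-0 with w 0 in e₀ | w 1 in e₁ | w 2 in e₂
  ... | zero     | _        | _        = 0 , e₀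
  ... | suc zero | zero     | _        = 1 , e₁
  ... | suc zero | suc zero | zero     = 2 , e₂
  ... | suc zero | suc zero | suc zero = ⊥-elim (no111 0 e₀ e₁ e₂)

  start : ℕ
  start = proj₁ first-0

  pos : ℕ → ℕ
  pos zero    = start
  pos (suc n) = pos n + blockLength (pos n)

  u : ℕ → Σ₃
  u n = letterAt (pos n)

  w-pos≡0 : ∀ n → w (pos n) ≡ 0₂
  w-pos≡0 zero    = proj₂ first-0
  w-pos≡0 (suc n) = proj₂ (block-at-0 (pos n) (w-pos≡0 n))

  slice-pos : ∀ j m → slice w (pos j) (length (g (slice u j m))) ≡ g (slice u j m)
  slice-pos j zero    = refl
  slice-pos j (suc m) = begin
    slice w (pos j) (length (g₁ (u j) ++ G))
      ≡⟨ cong (slice w (pos j)) (length-++ (g₁ (u j))) ⟩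
    slice w (pos j) (blockLength (pos j) + length G)
      ≡⟨ slice-+ w (pos j) (blockLength (pos j)) (length G) ⟩
    slice w (pos j) (blockLength (pos j)) ++ slice w (pos (suc j)) (length G)
      ≡⟨ cong₂ _++_ (proj₁ (block-at-0 (pos j) (w-pos≡0 j))) (slice-pos (suc j) m) ⟩
    g₁ (u j) ++ G
      ∎
    where
    open ≡-Reasoning
    G = g (slice u (suc j) m)

  pos-+ : ∀ j m → pos (j + m) ≡ pos j + length (g (slice u j m))
  pos-+ j zero    = trans (cong pos (+-identityʳ j)) (sym (+-identityʳ (pos j)))
  pos-+ j (suc m) = begin
    pos (j + suc m)                                      ≡⟨ cong pos (+-suc j m) ⟩
    pos (suc j + m)                                      ≡⟨ pos-+ (suc j) m ⟩
    pos j + blockLength (pos j) + length G               ≡⟨ +-assoc (pos j) _ _ ⟩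
    pos j + (blockLength (pos j) + length G)             ≡⟨ cong (pos j +_) (length-++ (g₁ (u j))) ⟨
    pos j + length (g₁ (u j) ++ G)                       ∎
    where
    open ≡-Reasoning
    G = g (slice u (suc j) m)

  g-window-occurs : ∀ {v} → FactorOfInf v u → FactorOfInf (g v ++ 0₂ ∷ []) w
  g-window-occurs {v} (j , eq) =
    pos j , subst (λ v → slice w (pos j) (length (g v ++ 0₂ ∷ [])) ≡ g v ++ 0₂ ∷ []) eq (begin
    slice w (pos j) (length (G ++ 0₂ ∷ []))
      ≡⟨ cong (slice w (pos j)) (length-++ G) ⟩
    slice w (pos j) (length G + 1)
      ≡⟨ slice-+ w (pos j) (length G) 1 ⟩
    slice w (pos j) (length G) ++ w (pos j + length G) ∷ []
      ≡⟨ cong₂ (λ s c → s ++ c ∷ []) (slice-pos j (length v)) next-0 ⟩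
    G ++ 0₂ ∷ []
      ∎)
    where
    open ≡-Reasoning
    G = g (slice u j (length v))
    next-0 : w (pos j + length G) ≡ 0₂
    next-0 = subst (λ k → w k ≡ 0₂) (pos-+ j (length v)) (w-pos≡0 (j + length v))

  g-occurs : ∀ {v} → FactorOfInf v u → FactorOfInf (g v) w
  g-occurs occ = factorOfInf-trans ([] , 0₂ ∷ [] , refl) (g-window-occurs occ)

  g-image : IsGImage (suffix w start) u
  g-image n = begin
    slice (suffix w start) 0 (length G)   ≡⟨ slice-suffix w start 0 (length G) ⟩
    slice w (start + 0) (length G)        ≡⟨ cong (λ k → slice w k (length G)) (+-identityʳ start) ⟩
    slice w start (length G)              ≡⟨ slice-pos 0 n ⟩
    G                                     ∎
    where
    open ≡-Reasoning
    G = g (slice u 0 n)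

module Properness (w : ℕ → Σ₂) (avoids : Avoids52PlusInf w) (factors4 : Length4FactorsAre w F) where

  factor∉F : ∀ {v} → FactorOfInf v w → length v ≡ 4 → False (v ∈? F) → ⊥
  factor∉F {v} occ |v|≡4 v∉F = toWitnessFalse v∉F (Equivalence.to (factors4 v |v|≡4) occ)

  no111 : No111 w
  no111 i e₀ e₁ e₂ = factor∉F (i , 111c) refl (111c∉F (w (3 + i)))
    where
    111c : slice w i 4 ≡ 1₂ ∷ 1₂ ∷ 1₂ ∷ w (3 + i) ∷ []
    111c = cong₂ _∷_ e₀ (cong₂ _∷_ e₁ (cong₂ _∷_ e₂ refl))
    111c∉F : ∀ c → False ((1₂ ∷ 1₂ ∷ 1₂ ∷ c ∷ []) ∈? F)
    111c∉F zero       = tt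
    111c∉F (suc zero) = tt

  open Decoding w no111 public

  window∉F : ∀ {W} → FactorOfInf W w → ∀ o →
             length (take 4 (drop o W)) ≡ 4 → False (take 4 (drop o W) ∈? F) → ⊥
  window∉F occ o = factor∉F (factorOfInf-trans (take-drop-factor o 4 _) occ)

  window-power : ∀ {W} → FactorOfInf W w → ∀ o l q →
                 True (isPeriod? _≟_ q (take l (drop o W))) →
                 True (5 * q <? 2 * length (take l (drop o W))) → ⊥
  window-power occ o l q per short = avoids _ (factorOfInf-trans (take-drop-factor o l _) occ)
    (period⇒52PlusPower _≟_ _ q (toWitness per) (toWitness short))

  10101c-absent : ∀ c → ¬ FactorOfInf (1₃ ∷ 0₃ ∷ 1₃ ∷ 0₃ ∷ 1₃ ∷ c ∷ []) u
  10101c-absent zero             occ = window-power (g-window-occurs occ) 0 11 4 tt tt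
  10101c-absent (suc zero)       occ = window∉F (g-window-occurs occ) 7 refl tt
  10101c-absent (suc (suc zero)) occ = window-power (g-window-occurs occ) 0 11 4 tt tt

  2121c-absent : ∀ c → ¬ FactorOfInf (2₃ ∷ 1₃ ∷ 2₃ ∷ 1₃ ∷ c ∷ []) u
  2121c-absent zero             occ = window-power (g-window-occurs occ) 0 8 3 tt tt
  2121c-absent (suc zero)       occ = window∉F (g-window-occurs occ) 4 refl tt
  2121c-absent (suc (suc zero)) occ = window-power (g-window-occurs occ) 0 8 3 tt tt

  forbidden-absent : All (λ f → ¬ FactorOfInf f u) forbidden
  forbidden-absent =
      (λ occ → window∉F (g-window-occurs occ) 2 refl tt)
    ∷ (λ occ → window-power (g-window-occurs occ) 0 3 1 tt tt)
    ∷ (λ occ → window∉F (g-window-occurs occ) 0 refl tt)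
    ∷ (λ occ → window∉F (g-window-occurs occ) 0 refl tt)
    ∷ (λ occ → let c , occ′ = factorOfInf-extend occ in 10101c-absent c occ′)
    ∷ (λ occ → let c , occ′ = factorOfInf-extend occ in 2121c-absent c occ′)
    ∷ (λ occ → window-power (g-window-occurs occ) 0 16 6 tt tt)
    ∷ []

  xyxyx-absent : ∀ x y → ParikhGt x y → ¬ FactorOfInf (x ++ y ++ x ++ y ++ x) u
  xyxyx-absent x y x>y occ = avoids _ (g-occurs occ) (subst Is52PlusPower (sym (g-xyxyx x y))
    (xyxyx-52PlusPower _≟_ (g x) (g y) (ParikhGt⇒length-g< x y x>y)))

  u-proper : ProperInf u
  u-proper v occ = (λ x y fac x>y → xyxyx-absent x y x>y (factorOfInf-trans fac occ))
                 , (λ f f∈forbidden fac → lookup forbidden-absent f∈forbidden (factorOfInf-trans fac occ))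

lemma7 : (w : ℕ → Σ₂) → Avoids52PlusInf w → Length4FactorsAre w F →
         Σ (ℕ → Σ₃) λ u → ProperInf u × ∃ λ k → IsGImage (suffix w k) u
lemma7 w avoids factors4 = u , u-proper , start , g-image
  where open Properness w avoids factors4
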